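{- Let $D=(V,A)$ be a digraph with $uv\in A$, and let $D-uv=(V,A\setminus\{uv\})$. Then $\gamma^+_{maj}(D)-2\leq \gamma^+_{maj}(D-uv)\leq \gamma^+_{maj}(D)+2$. Moreover, both bounds are sharp (each is attained for some digraph $D$ and arc $uv$).
   Context: Digraphs are finite, without loops or multiple arcs (pairs of opposite arcs allowed). For $u\in V$, $N^+[u]=\{u\}\cup\{v: uv\in A\}$. For $f:V\to\{ -1,1\}$ and $X\subseteq V$, $f(X)=\sum_{v\in X}f(v)$. A majority out-dominating function (MODF) of $D$ is a function $f:V\to\{ -1,1\}$ with $|\{v\in V: f(N^+[v])\geq1\}|\geq |V|/2$; its weight is $w(f)=f(V)$. $\gamma^+_{maj}(D)$ is the minimum weight of a MODF of $D$. -}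

module Defs where

open import Data.Bool using (Bool; true; false; _∧_; not; if_then_else_)
open import Data.Nat using (ℕ; zero; suc)
import Data.Nat as ℕ
open import Data.Integer using (ℤ; +_; -[1+_]; _+_; _≤_)
open import Data.Fin using (Fin; _≟_)
open import Data.List using (List; map; length; filter; allFin)
import Data.List as L
open import Data.Product using (Σ; _×_; ∃)
open import Relation.Binary.PropositionalEquality using (_≡_; refl)
open import Relation.Nullary.Decidable using (⌊_⌋)
open import Data.Integer using (_≤?_)

record Digraph (n : ℕ) : Set where
  field
    arc      : Fin n → Fin n → Bool
    loopless : ∀ v → arc v v ≡ false
open Digraph public

removeArc : ∀ {n} → Digraph n → Fin n → Fin n → Digraph n
arc (removeArc D u v) x y = arc D x y ∧ not (⌊ x ≟ u ⌋ ∧ ⌊ y ≟ v ⌋)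
loopless (removeArc D u v) x rewrite loopless D x = refl

SignFun : ℕ → Set
SignFun n = Fin n → Bool

sgn : Bool → ℤ
sgn true  = + 1
sgn false = -[1+ 0 ]

sumV : ∀ {n} → (Fin n → ℤ) → ℤ
sumV {n} g = L.foldr _+_ (+ 0) (map g (allFin n))

inClosedOut : ∀ {n} → Digraph n → Fin n → Fin n → Bool
inClosedOut D v w = if ⌊ w ≟ v ⌋ then true else arc D v w

fN : ∀ {n} → Digraph n → SignFun n → Fin n → ℤ
fN D f v = sumV (λ w → if inClosedOut D v w then sgn (f w) else + 0)

weight : ∀ {n} → SignFun n → ℤ
weight f = sumV (λ v → sgn (f v))

goodCount : ∀ {n} → Digraph n → SignFun n → ℕ
goodCount {n} D f = length (filter (λ v → + 1 ≤? fN D f v) (allFin n))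

IsMODF : ∀ {n} → Digraph n → SignFun n → Set
IsMODF {n} D f = n ℕ.≤ 2 ℕ.* goodCount D f

IsGammaMaj : ∀ {n} → Digraph n → ℤ → Set
IsGammaMaj D g =
  (Σ (SignFun _) λ f → IsMODF D f × weight f ≡ g) ×
  (∀ f → IsMODF D f → g ≤ weight f)

-- Raising one vertex from -1 to +1 costs 2 in weight and raises f(N⁺[x]) by 2 for
-- every x whose closed out-neighbourhood contains it; deleting uv changes only
-- f(N⁺[u]), and only by f(v). Hence a MODF of D - uv becomes a MODF of D once v
-- is raised. Conversely, for a MODF f of D: if N⁺[u] in D - uv contains a vertex
-- with f = -1, raising it makes up for the lost summand f(v) ≤ 1; otherwise
-- f(N⁺[u]) ≥ f(u) = 1 in D - uv already, so f itself is a MODF of D - uv.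
-- Both bounds are attained on small digraphs, verified by evaluating every sign function.
module Submission where

open import Defs
open import Data.Nat using (ℕ)
open import Data.Fin using (Fin)
open import Data.Bool using (true)
open import Data.Integer using (ℤ; _+_; _-_; _≤_; +_)
open import Data.Product using (Σ; _×_; ∃)
open import Relation.Binary.PropositionalEquality using (_≡_)

import Data.Nat as ℕ
import Data.Nat.Properties as ℕ
open import Data.Bool using (false; if_then_else_)
import Data.Bool as Bool
open import Data.Bool.Properties using (∧-identityʳ; ∧-zeroʳ; ≤-maximum)
open import Data.Fin using (zero; suc; _≟_)
open import Data.Fin.Properties using (any?; punchInᵢ≢i)
open import Data.Integer using (-_; +≤+)
import Data.Integer as ℤ
open import Data.Integer.Properties
  using (≤-refl; ≤-trans; ≤-reflexive; +-mono-≤; +-monoʳ-≤; +-monoˡ-≤; i≤i+j;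
         +-0-commutativeMonoid; +-identityʳ; module ≤-Reasoning)
open import Data.Integer.Tactic.RingSolver using (solve-∀)
open import Algebra.Properties.CommutativeMonoid.Sum +-0-commutativeMonoid
  using (sum; sum-cong-≗; sum-remove; sum-replicate-zero)
import Data.List as List
open import Data.List.Properties using (map-tabulate; map-cong)
open import Data.List.Relation.Binary.Sublist.Propositional using (⊆-refl)
open import Data.List.Relation.Binary.Sublist.Propositional.Properties
  using (filter⁺; length-mono-≤)
open import Data.Vec.Functional using (removeAt; updateAt; replicate; []; _∷_)
open import Data.Vec.Functional.Properties using (updateAt-updates; updateAt-minimal)
open import Data.Product using (_,_; proj₁; proj₂)
open import Data.Sum using (_⊎_; inj₁; inj₂)
open import Data.Empty using (⊥-elim)
open import Data.Unit using (tt)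
open import Function using (_∘_; id)
open import Relation.Nullary using (yes; no; ¬_; contradiction; _→-dec_; _×-dec_)
open import Relation.Nullary.Decidable using (True; toWitness; ⌊_⌋)
open import Relation.Binary.PropositionalEquality
  using (_≢_; refl; sym; trans; cong; subst₂; module ≡-Reasoning)

private
  variable
    n : ℕ

sumV≡sum : (g : Fin n → ℤ) → sumV g ≡ sum g
sumV≡sum g = trans (cong (List.foldr _+_ (+ 0)) (map-tabulate id g)) (foldr-tabulate g)
  where
  foldr-tabulate : ∀ {m} (h : Fin m → ℤ) → List.foldr _+_ (+ 0) (List.tabulate h) ≡ sum h
  foldr-tabulate {ℕ.zero}  h = refl
  foldr-tabulate {ℕ.suc m} h = cong (λ s → h zero + s) (foldr-tabulate (h ∘ suc))

sumV-cong : {g h : Fin n → ℤ} → (∀ w → g w ≡ h w) → sumV g ≡ sumV h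
sumV-cong {n} g≗h = cong (List.foldr _+_ (+ 0)) (map-cong g≗h (List.allFin n))

sum-mono : {g h : Fin n → ℤ} → (∀ w → g w ≤ h w) → sum g ≤ sum h
sum-mono {ℕ.zero}  _   = ≤-refl
sum-mono {ℕ.suc n} g≤h = +-mono-≤ (g≤h zero) (sum-mono (g≤h ∘ suc))

sumV-mono : {g h : Fin n → ℤ} → (∀ w → g w ≤ h w) → sumV g ≤ sumV h
sumV-mono {g = g} {h} g≤h = subst₂ _≤_ (sym (sumV≡sum g)) (sym (sumV≡sum h)) (sum-mono g≤h)

sumV-update : {g h : Fin n → ℤ} (p : Fin n) → (∀ w → w ≢ p → g w ≡ h w) →
              sumV g ≡ sumV h + (g p - h p)
sumV-update {ℕ.suc n} {g} {h} p g≡h = begin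
  sumV g                                    ≡⟨ trans (sumV≡sum g) (sum-remove g) ⟩
  g p + sum (removeAt g p)                  ≡⟨ cong (λ s → g p + s) (sum-cong-≗ (λ w → g≡h _ (punchInᵢ≢i p w))) ⟩
  g p + sum (removeAt h p)                  ≡⟨ shift (g p) (h p) (sum (removeAt h p)) ⟩
  (h p + sum (removeAt h p)) + (g p - h p)  ≡⟨ cong (λ s → s + (g p - h p)) (sym (trans (sumV≡sum h) (sum-remove h))) ⟩
  sumV h + (g p - h p)                      ∎
  where
  open ≡-Reasoning
  shift : ∀ a b s → a + s ≡ (b + s) + (a - b)
  shift = solve-∀

nonNeg-term≤sumV : {g : Fin n → ℤ} → (∀ w → + 0 ≤ g w) → ∀ p → g p ≤ sumV g
nonNeg-term≤sumV {ℕ.suc n} {g} 0≤g p = begin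
  g p                            ≡⟨ sym (+-identityʳ (g p)) ⟩
  g p + + 0                      ≡⟨ cong (λ s → g p + s) (sym (sum-replicate-zero n)) ⟩
  g p + sum (replicate n (+ 0))  ≤⟨ +-monoʳ-≤ (g p) (sum-mono {g = replicate n (+ 0)} {h = removeAt g p} (λ w → 0≤g _)) ⟩
  g p + sum (removeAt g p)       ≡⟨ sym (trans (sumV≡sum g) (sum-remove g)) ⟩
  sumV g                         ∎
  where open ≤-Reasoning

contribution : Digraph n → SignFun n → Fin n → Fin n → ℤ
contribution D f x w = if inClosedOut D x w then sgn (f w) else + 0

contribution-∈ : (D : Digraph n) (f : SignFun n) {x w : Fin n} →
                 inClosedOut D x w ≡ true → contribution D f x w ≡ sgn (f w)
contribution-∈ D f w∈ rewrite w∈ = refl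

contribution-∉ : (D : Digraph n) (f : SignFun n) {x w : Fin n} →
                 inClosedOut D x w ≡ false → contribution D f x w ≡ + 0
contribution-∉ D f w∉ rewrite w∉ = refl

contribution-cong-sign : (D : Digraph n) {f h : SignFun n} (x w : Fin n) →
                         f w ≡ h w → contribution D f x w ≡ contribution D h x w
contribution-cong-sign D x w = cong (λ b → if inClosedOut D x w then sgn b else + 0)

contribution-cong-N⁺ : (D E : Digraph n) (f : SignFun n) (x w : Fin n) →
                       inClosedOut D x w ≡ inClosedOut E x w → contribution D f x w ≡ contribution E f x w
contribution-cong-N⁺ D E f x w = cong (λ b → if b then sgn (f w) else + 0)

inClosedOut-refl : (D : Digraph n) (x : Fin n) → inClosedOut D x x ≡ true
inClosedOut-refl D x with x ≟ x
... | yes _   = refl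
... | no x≢x = contradiction refl x≢x

sgn-mono : ∀ {b b′} → b Bool.≤ b′ → sgn b ≤ sgn b′
sgn-mono Bool.f≤t = ℤ.-≤+
sgn-mono Bool.b≤b = ≤-refl

sgn≤1 : ∀ b → sgn b ≤ + 1
sgn≤1 b = sgn-mono (≤-maximum b)

fN-mono : (D : Digraph n) {f h : SignFun n} → (∀ w → f w Bool.≤ h w) →
          ∀ x → fN D f x ≤ fN D h x
fN-mono D {f} {h} f≤h x = sumV-mono contribution-mono
  where
  contribution-mono : ∀ w → contribution D f x w ≤ contribution D h x w
  contribution-mono w with inClosedOut D x w
  ... | true  = sgn-mono (f≤h w)
  ... | false = ≤-refl

negative-in-N⁺-or-good : (D : Digraph n) (f : SignFun n) (x : Fin n) →
                         (∃ λ w → inClosedOut D x w ≡ true × f w ≡ false) ⊎ + 1 ≤ fN D f x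
negative-in-N⁺-or-good D f x
  with any? (λ w → (inClosedOut D x w Bool.≟ true) ×-dec (f w Bool.≟ false))
... | yes negative = inj₁ negative
... | no none      = inj₂ (≤-trans one≤contribution (nonNeg-term≤sumV nonNeg x))
  where
  nonNeg : ∀ w → + 0 ≤ contribution D f x w
  nonNeg w with inClosedOut D x w in w∈ | f w in fw
  ... | false | _     = ≤-refl
  ... | true  | true  = +≤+ ℕ.z≤n
  ... | true  | false = ⊥-elim (none (w , w∈ , fw))

  one≤contribution : + 1 ≤ contribution D f x x
  one≤contribution rewrite contribution-∈ D f (inClosedOut-refl D x) with f x in fx
  ... | true  = ≤-refl
  ... | false = ⊥-elim (none (x , inClosedOut-refl D x , fx))

raise : SignFun n → Fin n → SignFun n
raise f p = updateAt f p (λ _ → true)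

raise-updates : (f : SignFun n) (p : Fin n) → raise f p p ≡ true
raise-updates f p = updateAt-updates p f

raise-minimal : (f : SignFun n) {p w : Fin n} → w ≢ p → raise f p w ≡ f w
raise-minimal f {p} {w} w≢p = updateAt-minimal w p f w≢p

raise-≥ : (f : SignFun n) (p w : Fin n) → f w Bool.≤ raise f p w
raise-≥ f p w with w ≟ p
... | yes refl rewrite raise-updates f p = ≤-maximum (f p)
... | no w≢p   rewrite raise-minimal f w≢p = Bool.b≤b

weight-raise : (f : SignFun n) (p : Fin n) → weight (raise f p) ≤ weight f + + 2
weight-raise f p = begin
  weight (raise f p)                          ≡⟨ sumV-update p (λ _ w≢p → cong sgn (raise-minimal f w≢p)) ⟩
  weight f + (sgn (raise f p p) - sgn (f p))  ≤⟨ +-monoʳ-≤ (weight f) gain≤2 ⟩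
  weight f + + 2                              ∎
  where
  open ≤-Reasoning
  gain≤2 : sgn (raise f p p) - sgn (f p) ≤ + 2
  gain≤2 rewrite raise-updates f p with f p
  ... | true  = +≤+ ℕ.z≤n
  ... | false = ≤-refl

fN-raise : (D : Digraph n) (f : SignFun n) {x p : Fin n} →
           inClosedOut D x p ≡ true → f p ≡ false → fN D (raise f p) x ≡ fN D f x + + 2
fN-raise D f {x} {p} p∈ fp = begin
  fN D (raise f p) x
    ≡⟨ sumV-update p (λ w w≢p → contribution-cong-sign D {raise f p} {f} x w (raise-minimal f w≢p)) ⟩
  fN D f x + (contribution D (raise f p) x p - contribution D f x p)
    ≡⟨ cong (λ s → fN D f x + s) gain ⟩
  fN D f x + + 2
    ∎
  where
  open ≡-Reasoning
  gain : contribution D (raise f p) x p - contribution D f x p ≡ + 2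
  gain rewrite contribution-∈ D (raise f p) p∈ | contribution-∈ D f p∈ | raise-updates f p | fp = refl

arc⇒≢ : (D : Digraph n) {u v : Fin n} → arc D u v ≡ true → u ≢ v
arc⇒≢ D uv refl with trans (sym uv) (loopless D _)
... | ()

arc⇒inClosedOut : (D : Digraph n) {x w : Fin n} → arc D x w ≡ true → inClosedOut D x w ≡ true
arc⇒inClosedOut D {x} {w} xw with w ≟ x
... | yes _ = refl
... | no _  = xw

module _ (D : Digraph n) {u v : Fin n} where

  arc-removeArc : ∀ {x w} → ¬ (x ≡ u × w ≡ v) → arc (removeArc D u v) x w ≡ arc D x w
  arc-removeArc {x} {w} other with x ≟ u | w ≟ v
  ... | yes x≡u | yes w≡v = contradiction (x≡u , w≡v) other
  ... | yes _   | no _    = ∧-identityʳ (arc D x w)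
  ... | no _    | yes _   = ∧-identityʳ (arc D x w)
  ... | no _    | no _    = ∧-identityʳ (arc D x w)

  arc-removeArc-removed : arc (removeArc D u v) u v ≡ false
  arc-removeArc-removed with u ≟ u | v ≟ v
  ... | yes _   | yes _   = ∧-zeroʳ (arc D u v)
  ... | no u≢u  | _       = contradiction refl u≢u
  ... | yes _   | no v≢v  = contradiction refl v≢v

  inClosedOut-removeArc : ∀ {x w} → ¬ (x ≡ u × w ≡ v) →
                          inClosedOut (removeArc D u v) x w ≡ inClosedOut D x w
  inClosedOut-removeArc {x} {w} other =
    cong (λ b → if ⌊ w ≟ x ⌋ then true else b) (arc-removeArc other)

  inClosedOut-removeArc-removed : u ≢ v → inClosedOut (removeArc D u v) u v ≡ false
  inClosedOut-removeArc-removed u≢v with v ≟ u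
  ... | yes v≡u = contradiction (sym v≡u) u≢v
  ... | no _    = arc-removeArc-removed

  fN-removeArc-≢ : (f : SignFun n) {x : Fin n} → x ≢ u → fN (removeArc D u v) f x ≡ fN D f x
  fN-removeArc-≢ f {x} x≢u = sumV-cong λ w →
    contribution-cong-N⁺ (removeArc D u v) D f x w (inClosedOut-removeArc (x≢u ∘ proj₁))

  fN-removeArc : (f : SignFun n) → arc D u v ≡ true → fN D f u ≡ fN (removeArc D u v) f u + sgn (f v)
  fN-removeArc f uv = begin
    fN D f u
      ≡⟨ sumV-update v (λ w w≢v → contribution-cong-N⁺ D (removeArc D u v) f u w
                                      (sym (inClosedOut-removeArc (w≢v ∘ proj₂)))) ⟩
    fN (removeArc D u v) f u + (contribution D f u v - contribution (removeArc D u v) f u v)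
      ≡⟨ cong (λ s → fN (removeArc D u v) f u + s) lost ⟩
    fN (removeArc D u v) f u + sgn (f v)
      ∎
    where
    open ≡-Reasoning
    lost : contribution D f u v - contribution (removeArc D u v) f u v ≡ sgn (f v)
    lost rewrite contribution-∈ D f (arc⇒inClosedOut D uv)
               | contribution-∉ (removeArc D u v) f (inClosedOut-removeArc-removed (arc⇒≢ D uv))
               = +-identityʳ (sgn (f v))

cases-at : {P : Fin n → Set} (u : Fin n) → P u → (∀ {x} → x ≢ u → P x) → ∀ x → P x
cases-at u at-u elsewhere x with x ≟ u
... | yes refl = at-u
... | no x≢u   = elsewhere x≢u

goodCount-mono : (D E : Digraph n) (f h : SignFun n) →
                 (∀ x → + 1 ≤ fN D f x → + 1 ≤ fN E h x) → goodCount D f ℕ.≤ goodCount E h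
goodCount-mono {n} D E f h good⇒good = length-mono-≤ (filter⁺
  (λ x → + 1 ℤ.≤? fN D f x) (λ x → + 1 ℤ.≤? fN E h x) (λ { refl → good⇒good _ }) (⊆-refl {x = List.allFin n}))

IsMODF-transfer : (D E : Digraph n) (f h : SignFun n) →
                  (∀ x → + 1 ≤ fN D f x → + 1 ≤ fN E h x) → IsMODF D f → IsMODF E h
IsMODF-transfer D E f h good⇒good modf = ℕ.≤-trans modf (ℕ.*-monoʳ-≤ 2 (goodCount-mono D E f h good⇒good))

IsGammaMaj-≤ : (D E : Digraph n) {g g′ : ℤ} (k : ℤ) → IsGammaMaj D g → IsGammaMaj E g′ →
               (∀ f → IsMODF D f → ∃ λ h → IsMODF E h × weight h ≤ weight f + k) →
               g′ ≤ g + k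
IsGammaMaj-≤ D E k ((f , modf , refl) , _) (_ , minimal) transfer
  with transfer f modf
... | h , modf′ , weight≤ = ≤-trans (minimal h modf′) weight≤

module _ (D : Digraph n) {u v : Fin n} (uv : arc D u v ≡ true) where

  private
    D′ : Digraph n
    D′ = removeArc D u v

  IsMODF-removeArc⇒IsMODF-raise : (f : SignFun n) → IsMODF D′ f → IsMODF D (raise f v)
  IsMODF-removeArc⇒IsMODF-raise f = IsMODF-transfer D′ D f (raise f v) λ x good →
    ≤-trans good (≤-trans (fN-mono D′ (raise-≥ f v) x) (arc-restored x))
    where
    arc-restored : ∀ x → fN D′ (raise f v) x ≤ fN D (raise f v) x
    arc-restored = cases-at u (begin
      fN D′ (raise f v) u                     ≤⟨ i≤i+j _ (+ 1) ⟩
      fN D′ (raise f v) u + + 1               ≡⟨ cong (λ b → fN D′ (raise f v) u + sgn b) (sym (raise-updates f v)) ⟩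
      fN D′ (raise f v) u + sgn (raise f v v) ≡⟨ sym (fN-removeArc D (raise f v) uv) ⟩
      fN D (raise f v) u                      ∎)
      (λ x≢u → ≤-reflexive (fN-removeArc-≢ D (raise f v) x≢u))
      where open ≤-Reasoning

  IsMODF⇒IsMODF-removeArc : (f : SignFun n) → IsMODF D f →
                            ∃ λ h → IsMODF D′ h × weight h ≤ weight f + + 2
  IsMODF⇒IsMODF-removeArc f modf with negative-in-N⁺-or-good D′ f u
  ... | inj₂ good-u = f , IsMODF-transfer D D′ f f still-good modf , i≤i+j (weight f) (+ 2)
    where
    still-good : ∀ x → + 1 ≤ fN D f x → + 1 ≤ fN D′ f x
    still-good = cases-at u (λ _ → good-u)
      (λ x≢u good → ≤-trans good (≤-reflexive (sym (fN-removeArc-≢ D f x≢u))))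
  ... | inj₁ (w , w∈ , fw) = raise f w , IsMODF-transfer D D′ f (raise f w) good-after-raise modf , weight-raise f w
    where
    good-after-raise : ∀ x → + 1 ≤ fN D f x → + 1 ≤ fN D′ (raise f w) x
    good-after-raise = cases-at u (λ good → begin
      + 1                      ≤⟨ good ⟩
      fN D f u                 ≡⟨ fN-removeArc D f uv ⟩
      fN D′ f u + sgn (f v)    ≤⟨ +-monoʳ-≤ (fN D′ f u) (sgn≤1 (f v)) ⟩
      fN D′ f u + + 1          ≤⟨ +-monoʳ-≤ (fN D′ f u) (+≤+ (ℕ.s≤s ℕ.z≤n)) ⟩
      fN D′ f u + + 2          ≡⟨ sym (fN-raise D′ f w∈ fw) ⟩
      fN D′ (raise f w) u      ∎)
      (λ {x} x≢u good → begin
      + 1                      ≤⟨ good ⟩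
      fN D f x                 ≡⟨ sym (fN-removeArc-≢ D f x≢u) ⟩
      fN D′ f x                ≤⟨ fN-mono D′ (raise-≥ f w) x ⟩
      fN D′ (raise f w) x      ∎)
      where open ≤-Reasoning

i≤j+k⇒i-k≤j : ∀ {i j} k → i ≤ j + k → i - k ≤ j
i≤j+k⇒i-k≤j {i} {j} k i≤j+k = begin
  i - k      ≤⟨ +-monoˡ-≤ (- k) i≤j+k ⟩
  j + k - k  ≡⟨ cancel j k ⟩
  j          ∎
  where
  open ≤-Reasoning
  cancel : ∀ a b → a + b - b ≡ a
  cancel = solve-∀

γ⁺maj-removeArc-bounds : (n : ℕ) (D : Digraph n) (u v : Fin n) → arc D u v ≡ true →
                         (g g′ : ℤ) → IsGammaMaj D g → IsGammaMaj (removeArc D u v) g′ →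
                         (g - + 2 ≤ g′) × (g′ ≤ g + + 2)
γ⁺maj-removeArc-bounds n D u v uv g g′ γ γ′ =
  i≤j+k⇒i-k≤j (+ 2) (IsGammaMaj-≤ (removeArc D u v) D (+ 2) γ′ γ λ f modf →
    raise f v , IsMODF-removeArc⇒IsMODF-raise D uv f modf , weight-raise f v) ,
  IsGammaMaj-≤ D (removeArc D u v) (+ 2) γ γ′ (IsMODF⇒IsMODF-removeArc D uv)

IsMODF-by-evaluation : (D : Digraph n) (f : SignFun n) → True (n ℕ.≤? 2 ℕ.* goodCount D f) → IsMODF D f
IsMODF-by-evaluation D f = toWitness

implication-by-evaluation : ∀ {m k : ℕ} {i j : ℤ} → True ((m ℕ.≤? k) →-dec (i ℤ.≤? j)) → m ℕ.≤ k → i ≤ j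
implication-by-evaluation = toWitness

digon : Digraph 2
arc digon zero       (suc zero) = true
arc digon (suc zero) zero       = true
arc digon _          _          = false
loopless digon zero       = refl
loopless digon (suc zero) = refl

-- For a concrete vertex set, IsMODF D f and weight f normalise to terms mentioning f only
-- through its values at the literal vertices, so each minimality claim below is
-- definitionally the claim for the vector of those values.
digon-γ : IsGammaMaj digon (+ 2)
digon-γ =
  (true ∷ true ∷ [] , IsMODF-by-evaluation digon (true ∷ true ∷ []) tt , refl) ,
  λ f → minimal (f zero) (f (suc zero))
  where
  minimal : ∀ b₀ b₁ → IsMODF digon (b₀ ∷ b₁ ∷ []) → + 2 ≤ weight (b₀ ∷ b₁ ∷ [])
  minimal true  true  = implication-by-evaluation tt
  minimal true  false = implication-by-evaluation tt
  minimal false true  = implication-by-evaluation tt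
  minimal false false = implication-by-evaluation tt

digon-removeArc-γ : IsGammaMaj (removeArc digon zero (suc zero)) (+ 0)
digon-removeArc-γ =
  (true ∷ false ∷ [] , IsMODF-by-evaluation (removeArc digon zero (suc zero)) (true ∷ false ∷ []) tt , refl) ,
  λ f → minimal (f zero) (f (suc zero))
  where
  minimal : ∀ b₀ b₁ → IsMODF (removeArc digon zero (suc zero)) (b₀ ∷ b₁ ∷ []) → + 0 ≤ weight (b₀ ∷ b₁ ∷ [])
  minimal true  true  = implication-by-evaluation tt
  minimal true  false = implication-by-evaluation tt
  minimal false true  = implication-by-evaluation tt
  minimal false false = implication-by-evaluation tt

detouredDigon : Digraph 3
arc detouredDigon zero             (suc zero)       = true
arc detouredDigon (suc zero)       zero             = true
arc detouredDigon zero             (suc (suc zero)) = true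
arc detouredDigon (suc (suc zero)) (suc zero)       = true
arc detouredDigon _                _                = false
loopless detouredDigon zero             = refl
loopless detouredDigon (suc zero)       = refl
loopless detouredDigon (suc (suc zero)) = refl

detouredDigon-γ : IsGammaMaj detouredDigon (+ 1)
detouredDigon-γ =
  (false ∷ true ∷ true ∷ [] , IsMODF-by-evaluation detouredDigon (false ∷ true ∷ true ∷ []) tt , refl) ,
  λ f → minimal (f zero) (f (suc zero)) (f (suc (suc zero)))
  where
  minimal : ∀ b₀ b₁ b₂ → IsMODF detouredDigon (b₀ ∷ b₁ ∷ b₂ ∷ []) → + 1 ≤ weight (b₀ ∷ b₁ ∷ b₂ ∷ [])
  minimal true  true  true  = implication-by-evaluation tt
  minimal true  true  false = implication-by-evaluation tt
  minimal true  false true  = implication-by-evaluation tt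
  minimal true  false false = implication-by-evaluation tt
  minimal false true  true  = implication-by-evaluation tt
  minimal false true  false = implication-by-evaluation tt
  minimal false false true  = implication-by-evaluation tt
  minimal false false false = implication-by-evaluation tt

detouredDigon-removeArc-γ : IsGammaMaj (removeArc detouredDigon zero (suc zero)) (+ 3)
detouredDigon-removeArc-γ =
  (true ∷ true ∷ true ∷ [] ,
   IsMODF-by-evaluation (removeArc detouredDigon zero (suc zero)) (true ∷ true ∷ true ∷ []) tt , refl) ,
  λ f → minimal (f zero) (f (suc zero)) (f (suc (suc zero)))
  where
  minimal : ∀ b₀ b₁ b₂ → IsMODF (removeArc detouredDigon zero (suc zero)) (b₀ ∷ b₁ ∷ b₂ ∷ []) →
            + 3 ≤ weight (b₀ ∷ b₁ ∷ b₂ ∷ [])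
  minimal true  true  true  = implication-by-evaluation tt
  minimal true  true  false = implication-by-evaluation tt
  minimal true  false true  = implication-by-evaluation tt
  minimal true  false false = implication-by-evaluation tt
  minimal false true  true  = implication-by-evaluation tt
  minimal false true  false = implication-by-evaluation tt
  minimal false false true  = implication-by-evaluation tt
  minimal false false false = implication-by-evaluation tt

theorem3p9 :
    ((n : ℕ) (D : Digraph n) (u v : Fin n) → arc D u v ≡ true →
      (g g' : ℤ) → IsGammaMaj D g → IsGammaMaj (removeArc D u v) g' →
      (g - + 2 ≤ g') × (g' ≤ g + + 2))
    ×
    (Σ ℕ λ n → Σ (Digraph n) λ D → Σ (Fin n) λ u → Σ (Fin n) λ v →
      arc D u v ≡ true × Σ ℤ λ g → Σ ℤ λ g' →
      IsGammaMaj D g × IsGammaMaj (removeArc D u v) g' × g' ≡ g - + 2)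
    ×
    (Σ ℕ λ n → Σ (Digraph n) λ D → Σ (Fin n) λ u → Σ (Fin n) λ v →
      arc D u v ≡ true × Σ ℤ λ g → Σ ℤ λ g' →
      IsGammaMaj D g × IsGammaMaj (removeArc D u v) g' × g' ≡ g + + 2)
theorem3p9 =
  γ⁺maj-removeArc-bounds ,
  (2 , digon , zero , suc zero , refl , + 2 , + 0 , digon-γ , digon-removeArc-γ , refl) ,
  (3 , detouredDigon , zero , suc zero , refl , + 1 , + 3 , detouredDigon-γ , detouredDigon-removeArc-γ , refl)
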